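{- Let $G=(V,E)$ be an undirected graph and $S\subseteq V$. Suppose $Z\subseteq V$ is an $S$-weak region such that $ext(Z)\subseteq S$. Then $Z\subseteq\mathcal{P}_S$.
   Context: For an undirected graph $G=(V,E)$ and $S\subseteq V$, $\mathcal{P}_S$ is obtained by (Rule 1) putting every node of $S$ and every neighbor of a node of $S$ into $\mathcal{P}_S$, and (Rule 2) repeatedly: if $v\in\mathcal{P}_S$ and all neighbors of $v$ except exactly one neighbor $w$ are in $\mathcal{P}_S$, insert $w$. For $R\subseteq V$, $nbr(R)=\{v\in V\setminus R: v \text{ is adjacent to some } u\in R\}$ and $ext(R)=nbr(V\setminus R)$ (the nodes of $R$ adjacent to some node of $V\setminus R$). A set $R$ is an $S$-strong region if $R\not\subseteq\mathcal{P}_{S\cup nbr(R)}$; otherwise $R$ is an $S$-weak region. -}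

module Defs where

open import Data.Nat using (ℕ)
open import Data.Bool using (Bool; true; false)
open import Data.Fin using (Fin)
open import Data.Fin.Subset using (Subset; _∈_; _∉_)
open import Data.Product using (Σ; _×_; ∃)
open import Data.Sum using (_⊎_)
open import Relation.Nullary using (¬_)
open import Relation.Binary.PropositionalEquality using (_≡_; _≢_)
open import Relation.Unary using (Pred)
open import Level using (0ℓ)

record Graph (n : ℕ) : Set where
  field
    adj   : Fin n → Fin n → Bool
    sym   : ∀ u v → adj u v ≡ adj v u
    loopless : ∀ v → adj v v ≡ false

open Graph public

Adj : ∀ {n} → Graph n → Fin n → Fin n → Set
Adj G u v = adj G u v ≡ true

VSet : ℕ → Set₁
VSet n = Pred (Fin n) 0ℓ

⟦_⟧ : ∀ {n} → Subset n → VSet n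
⟦ A ⟧ v = v ∈ A

_∪ₚ_ : ∀ {n} → VSet n → VSet n → VSet n
(A ∪ₚ B) v = A v ⊎ B v

∁ₚ : ∀ {n} → VSet n → VSet n
∁ₚ A v = ¬ A v

_⊆ₚ_ : ∀ {n} → VSet n → VSet n → Set
A ⊆ₚ B = ∀ v → A v → B v

nbr : ∀ {n} → Graph n → VSet n → VSet n
nbr G R v = ¬ R v × ∃ λ u → R u × Adj G u v

ext : ∀ {n} → Graph n → VSet n → VSet n
ext G R = nbr G (∁ₚ R)

data 𝒫 {n} (G : Graph n) (S : VSet n) : Fin n → Set where
  rule1-self : ∀ {v} → S v → 𝒫 G S v
  rule1-nbr  : ∀ {u v} → S u → Adj G u v → 𝒫 G S v
  rule2      : ∀ {v w} → 𝒫 G S v → Adj G v w →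
               (∀ x → Adj G v x → x ≢ w → 𝒫 G S x) → 𝒫 G S w

Strong : ∀ {n} → Graph n → VSet n → VSet n → Set
Strong G S R = ¬ (R ⊆ₚ 𝒫 G (S ∪ₚ nbr G R))

Weak : ∀ {n} → Graph n → VSet n → VSet n → Set
Weak G S R = R ⊆ₚ 𝒫 G (S ∪ₚ nbr G R)

-- A derivation of a vertex of Z in 𝒫_{S ∪ nbr(Z)} replays in 𝒫_S. Seeds from
-- nbr(Z) never lie in Z; whenever a step crosses from outside Z into Z it lands
-- in ext(Z) ⊆ S, a Rule 1 seed of 𝒫_S; and the neighbours outside Z of a vertex
-- of Z are adjacent to ext(Z) ⊆ S, hence in 𝒫_S by Rule 1.
module Submission where

open import Data.Fin.Subset using (Subset)
open import Data.Fin.Subset.Properties using (_∈?_)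
open import Data.Product using (_,_)
open import Data.Sum using (inj₁; inj₂)
open import Relation.Nullary using (¬_; yes; no; contradiction)
open import Relation.Unary using (Decidable)
open import Relation.Binary.PropositionalEquality using (trans; _≢_)
open import Defs

module _ {n} (G : Graph n) where

  Adj-sym : ∀ {u v} → Adj G u v → Adj G v u
  Adj-sym {u} {v} = trans (Graph.sym G v u)

  ∈-ext : ∀ {Z u w} → ¬ Z u → Adj G u w → Z w → ext G Z w
  ∈-ext {u = u} u∉Z u~w w∈Z = (λ w∉Z → w∉Z w∈Z) , u , u∉Z , u~w

  ∪-nbr-∩⇒ˡ : ∀ {S Z : VSet n} {x} → (S ∪ₚ nbr G Z) x → Z x → S x
  ∪-nbr-∩⇒ˡ (inj₁ x∈S)        _   = x∈S
  ∪-nbr-∩⇒ˡ (inj₂ (x∉Z , _)) x∈Z = contradiction x∈Z x∉Z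

  𝒫-∪-nbr-∩⇒𝒫 : ∀ {S Z} → Decidable Z → ext G Z ⊆ₚ S →
                 ∀ {x} → 𝒫 G (S ∪ₚ nbr G Z) x → Z x → 𝒫 G S x
  𝒫-∪-nbr-∩⇒𝒫 {S} {Z} Z? ext⊆S = replay
    where
    replay : ∀ {x} → 𝒫 G (S ∪ₚ nbr G Z) x → Z x → 𝒫 G S x
    replay (rule1-self x∈T) x∈Z = rule1-self (∪-nbr-∩⇒ˡ {S} x∈T x∈Z)
    replay (rule1-nbr {u} u∈T u~w) w∈Z with Z? u
    ... | yes u∈Z = rule1-nbr (∪-nbr-∩⇒ˡ {S} u∈T u∈Z) u~w
    ... | no  u∉Z = rule1-self (ext⊆S _ (∈-ext u∉Z u~w w∈Z))
    replay (rule2 {v} {w} v∈𝒫 v~w others) w∈Z with Z? v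
    ... | no  v∉Z = rule1-self (ext⊆S _ (∈-ext v∉Z v~w w∈Z))
    ... | yes v∈Z = rule2 (replay v∈𝒫 v∈Z) v~w others′
      where
      others′ : ∀ x → Adj G v x → x ≢ w → 𝒫 G S x
      others′ x v~x x≢w with Z? x
      ... | yes x∈Z = replay (others x v~x x≢w) x∈Z
      ... | no  x∉Z = rule1-nbr (ext⊆S _ (∈-ext x∉Z (Adj-sym v~x) v∈Z)) v~x

lemma3 : ∀ {n} (G : Graph n) (S Z : Subset n) →
    Weak G ⟦ S ⟧ ⟦ Z ⟧ →
    ext G ⟦ Z ⟧ ⊆ₚ ⟦ S ⟧ →
    ⟦ Z ⟧ ⊆ₚ 𝒫 G ⟦ S ⟧
lemma3 G S Z weak ext⊆S v v∈Z =
  𝒫-∪-nbr-∩⇒𝒫 G (_∈? Z) ext⊆S (weak v v∈Z) v∈Z
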